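{- Let $d = kp$ where $k$ is a positive integer and $p$ is a prime, and suppose there is a positive integer $z$ dividing $k$ with $p \nmid z$. If $H_d = H_k$, then $H_{d/z} = H_{k/z}$.
   Context: For a positive integer $m$, $H_m = \langle a,b,c \mid a^2,b^2,c^2,(ab)^3,(ac)^2,(bc)^m,(bac)^m\rangle$. We write $H_m = H_n$ if the two presentations define the same quotient of the free group on $a,b,c$ (the normal closures of the relator sets in the free group coincide). -}

module Defs where

open import Data.Nat using (ℕ)
open import Data.Fin using (Fin; zero; suc)
open import Data.Bool using (Bool; true; false; not)
open import Data.Product using (_×_; _,_)
open import Data.List using (List; []; _∷_; _++_; reverse; map; concat; replicate)
open import Data.List.Membership.Propositional using (_∈_)

-- Letters of the free group on three generators a = 0, b = 1, c = 2.
-- (i , false) is the generator i, (i , true) is its inverse.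
Letter : Set
Letter = Fin 3 × Bool

Word : Set
Word = List Letter

invL : Letter → Letter
invL (i , e) = (i , not e)

invW : Word → Word
invW w = reverse (map invL w)

gen : Fin 3 → Word
gen i = (i , false) ∷ []

a b c : Word
a = gen zero
b = gen (suc zero)
c = gen (suc (suc zero))

pow : Word → ℕ → Word
pow w n = concat (replicate n w)

data _≈F_ : Word → Word → Set where
  cancel : ∀ u x v → (u ++ x ∷ invL x ∷ v) ≈F (u ++ v)
  ≈refl  : ∀ {u} → u ≈F u
  ≈sym   : ∀ {u v} → u ≈F v → v ≈F u
  ≈trans : ∀ {u v w} → u ≈F v → v ≈F w → u ≈F w

data NormalClosure (R : List Word) : Word → Set where
  nc-one  : NormalClosure R []
  nc-conj : ∀ {r} → r ∈ R → (g : Word) → NormalClosure R (g ++ r ++ invW g)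
  nc-inv  : ∀ {w} → NormalClosure R w → NormalClosure R (invW w)
  nc-mul  : ∀ {u v} → NormalClosure R u → NormalClosure R v → NormalClosure R (u ++ v)
  nc-resp : ∀ {u v} → u ≈F v → NormalClosure R u → NormalClosure R v

-- Two presentations on a,b,c define the same quotient of the free group:
-- the normal closures of their relator sets coincide.
SamePresentation : List Word → List Word → Set
SamePresentation R S =
  (∀ w → NormalClosure R w → NormalClosure S w) ×
  (∀ w → NormalClosure S w → NormalClosure R w)

Hrel : ℕ → List Word
Hrel m =
  pow a 2 ∷ pow b 2 ∷ pow c 2 ∷ pow (a ++ b) 3 ∷ pow (a ++ c) 2 ∷
  pow (b ++ c) m ∷ pow (b ++ a ++ c) m ∷ []

-- Writing k = q z, the claim becomes: H_{qzp} = H_{qz} implies H_{qp} = H_q.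
-- The presentations H_m differ only in the exponent m of the two relators
-- (bc)^m and (bac)^m, so everything reduces to exponent arithmetic inside a
-- normal closure N:
--   * N is closed under conjugation, products, inverses and left cancellation,
--     hence an inclusion ⟨⟨R⟩⟩ ⊆ ⟨⟨S⟩⟩ follows from R ⊆ ⟨⟨S⟩⟩;
--   * if x^m ∈ N then x^n ∈ N for every multiple n of m, and if x^m, x^n ∈ N
--     then x^{gcd m n} ∈ N (Bézout);
--   * consequently m ∣ n gives ⟨⟨H_n⟩⟩ ⊆ ⟨⟨H_m⟩⟩.
-- For the theorem, x^{qz} ∈ ⟨⟨H_{qz}⟩⟩ = ⟨⟨H_{qzp}⟩⟩ ⊆ ⟨⟨H_{qp}⟩⟩ and
-- x^{qp} ∈ ⟨⟨H_{qp}⟩⟩ for x = bc, bac, so x^q = x^{gcd(qz,qp)} ∈ ⟨⟨H_{qp}⟩⟩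
-- because z and p are coprime; the reverse inclusion is the divisibility one.
module Submission where

open import Defs
open import Data.Nat using (ℕ; _*_; _/_; NonZero)
open import Data.Nat.Divisibility using (_∣_)
open import Data.Nat.Primality using (Prime)
open import Relation.Nullary using (¬_)

open import Data.Nat using (zero; suc; _+_)
open import Data.Nat.Properties using (+-comm; *-comm; *-assoc; *-identityʳ)
open import Data.Nat.Divisibility using (divides; m∣m*n; *-monoˡ-∣)
open import Data.Nat.DivMod using (m*n/n≡m)
open import Data.Nat.Primality using (prime⇒irreducible)
open import Data.Nat.Coprimality using (Coprime; coprime⇒gcd≡1)
open import Data.Nat.GCD using (gcd; gcd-GCD; c*gcd[m,n]≡gcd[cm,cn]; module Bézout)
open import Data.Bool using (true; false)
open import Data.Product using (_,_)
open import Data.Sum using (inj₁; inj₂)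
open import Data.Empty using (⊥-elim)
open import Data.List using ([]; _∷_; _++_; reverse; map; [_])
open import Data.List.Properties using (++-assoc; ++-identityʳ; unfold-reverse; reverse-++; map-++)
open import Data.List.Relation.Unary.Any using (here; there)
open import Data.List.Membership.Propositional using (_∈_)
open import Relation.Binary.PropositionalEquality hiding ([_])
open ≡-Reasoning

invL-involutive : ∀ x → invL (invL x) ≡ x
invL-involutive (i , true) = refl
invL-involutive (i , false) = refl

invW-++ : ∀ u v → invW (u ++ v) ≡ invW v ++ invW u
invW-++ u v = trans (cong reverse (map-++ invL u v)) (reverse-++ (map invL u) (map invL v))

invW-involutive : ∀ u → invW (invW u) ≡ u
invW-involutive [] = refl
invW-involutive (x ∷ u) = begin
  invW (invW (x ∷ u))          ≡⟨ cong invW (unfold-reverse (invL x) (map invL u)) ⟩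
  invW (invW u ++ [ invL x ])  ≡⟨ invW-++ (invW u) [ invL x ] ⟩
  invL (invL x) ∷ invW (invW u) ≡⟨ cong₂ _∷_ (invL-involutive x) (invW-involutive u) ⟩
  x ∷ u                         ∎

≡⇒≈F : ∀ {u v} → u ≡ v → u ≈F v
≡⇒≈F refl = ≈refl

invW-cancelˡ : ∀ u v → (invW u ++ (u ++ v)) ≈F v
invW-cancelˡ [] v = ≈refl
invW-cancelˡ (x ∷ u) v =
  ≈trans (≡⇒≈F regroup) (≈trans (cancel (invW u) (invL x) (u ++ v)) (invW-cancelˡ u v))
  where
  regroup : invW (x ∷ u) ++ (x ∷ (u ++ v)) ≡ invW u ++ invL x ∷ invL (invL x) ∷ (u ++ v)
  regroup = begin
    invW (x ∷ u) ++ (x ∷ (u ++ v))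
      ≡⟨ cong (_++ (x ∷ (u ++ v))) (unfold-reverse (invL x) (map invL u)) ⟩
    (invW u ++ [ invL x ]) ++ (x ∷ (u ++ v))
      ≡⟨ ++-assoc (invW u) [ invL x ] _ ⟩
    invW u ++ invL x ∷ x ∷ (u ++ v)
      ≡⟨ cong (λ y → invW u ++ invL x ∷ y ∷ (u ++ v)) (sym (invL-involutive x)) ⟩
    invW u ++ invL x ∷ invL (invL x) ∷ (u ++ v) ∎

invW-cancelʳ : ∀ u v → (u ++ (invW u ++ v)) ≈F v
invW-cancelʳ u v =
  subst (λ t → (t ++ (invW u ++ v)) ≈F v) (invW-involutive u) (invW-cancelˡ (invW u) v)

≈F-++ˡ : ∀ p {u v} → u ≈F v → (p ++ u) ≈F (p ++ v)
≈F-++ˡ p (cancel u x v) =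
  ≈trans (≡⇒≈F (sym (++-assoc p u _)))
    (≈trans (cancel (p ++ u) x v) (≡⇒≈F (++-assoc p u v)))
≈F-++ˡ p ≈refl = ≈refl
≈F-++ˡ p (≈sym e) = ≈sym (≈F-++ˡ p e)
≈F-++ˡ p (≈trans e f) = ≈trans (≈F-++ˡ p e) (≈F-++ˡ p f)

≈F-++ʳ : ∀ s {u v} → u ≈F v → (u ++ s) ≈F (v ++ s)
≈F-++ʳ s (cancel u x v) =
  ≈trans (≡⇒≈F (++-assoc u (x ∷ invL x ∷ v) s))
    (≈trans (cancel u x (v ++ s)) (≡⇒≈F (sym (++-assoc u v s))))
≈F-++ʳ s ≈refl = ≈refl
≈F-++ʳ s (≈sym e) = ≈sym (≈F-++ʳ s e)
≈F-++ʳ s (≈trans e f) = ≈trans (≈F-++ʳ s e) (≈F-++ʳ s f)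

NC-conj : ∀ {S w} → NormalClosure S w → ∀ g → NormalClosure S (g ++ w ++ invW g)
NC-conj nc-one g =
  nc-resp (≈sym (≈trans (≡⇒≈F (cong (g ++_) (sym (++-identityʳ (invW g))))) (invW-cancelʳ g [])))
    nc-one
NC-conj {S} (nc-conj {r} r∈ h) g = subst (NormalClosure S) regroup (nc-conj r∈ (g ++ h))
  where
  regroup : (g ++ h) ++ r ++ invW (g ++ h) ≡ g ++ (h ++ r ++ invW h) ++ invW g
  regroup = begin
    (g ++ h) ++ r ++ invW (g ++ h)     ≡⟨ cong (λ t → (g ++ h) ++ r ++ t) (invW-++ g h) ⟩
    (g ++ h) ++ r ++ invW h ++ invW g  ≡⟨ ++-assoc g h _ ⟩
    g ++ h ++ r ++ invW h ++ invW g    ≡⟨ cong (λ t → g ++ h ++ t) (sym (++-assoc r (invW h) (invW g))) ⟩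
    g ++ h ++ (r ++ invW h) ++ invW g  ≡⟨ cong (g ++_) (sym (++-assoc h (r ++ invW h) (invW g))) ⟩
    g ++ (h ++ r ++ invW h) ++ invW g  ∎
NC-conj {S} (nc-inv {w} n) g = subst (NormalClosure S) regroup (nc-inv (NC-conj n g))
  where
  regroup : invW (g ++ w ++ invW g) ≡ g ++ invW w ++ invW g
  regroup = begin
    invW (g ++ w ++ invW g)              ≡⟨ invW-++ g (w ++ invW g) ⟩
    invW (w ++ invW g) ++ invW g         ≡⟨ cong (_++ invW g) (invW-++ w (invW g)) ⟩
    (invW (invW g) ++ invW w) ++ invW g  ≡⟨ cong (λ t → (t ++ invW w) ++ invW g) (invW-involutive g) ⟩
    (g ++ invW w) ++ invW g              ≡⟨ ++-assoc g (invW w) (invW g) ⟩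
    g ++ invW w ++ invW g                ∎
NC-conj (nc-mul {u} {v} nu nv) g = nc-resp merge (nc-mul (NC-conj nu g) (NC-conj nv g))
  where
  merge : ((g ++ u ++ invW g) ++ (g ++ v ++ invW g)) ≈F (g ++ (u ++ v) ++ invW g)
  merge =
    ≈trans (≡⇒≈F (trans (++-assoc g (u ++ invW g) _) (cong (g ++_) (++-assoc u (invW g) _))))
      (≈trans (≈F-++ˡ g (≈F-++ˡ u (invW-cancelˡ g (v ++ invW g))))
        (≡⇒≈F (cong (g ++_) (sym (++-assoc u v (invW g))))))
NC-conj (nc-resp e n) g = nc-resp (≈F-++ˡ g (≈F-++ʳ (invW g) e)) (NC-conj n g)

NC-relator : ∀ {R r} → r ∈ R → NormalClosure R r
NC-relator {R} {r} r∈ = subst (NormalClosure R) (++-identityʳ r) (nc-conj r∈ [])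

NC-⊆ : ∀ {R S} → (∀ {r} → r ∈ R → NormalClosure S r) →
       ∀ {w} → NormalClosure R w → NormalClosure S w
NC-⊆ f nc-one = nc-one
NC-⊆ f (nc-conj r∈ g) = NC-conj (f r∈) g
NC-⊆ f (nc-inv n) = nc-inv (NC-⊆ f n)
NC-⊆ f (nc-mul nu nv) = nc-mul (NC-⊆ f nu) (NC-⊆ f nv)
NC-⊆ f (nc-resp e n) = nc-resp e (NC-⊆ f n)

NC-cancelˡ : ∀ {S} u v → NormalClosure S (u ++ v) → NormalClosure S u → NormalClosure S v
NC-cancelˡ u v huv hu = nc-resp (invW-cancelˡ u v) (nc-mul (nc-inv hu) huv)

pow-+ : ∀ w m n → pow w (m + n) ≡ pow w m ++ pow w n
pow-+ w zero n = refl
pow-+ w (suc m) n = trans (cong (w ++_) (pow-+ w m n)) (sym (++-assoc w (pow w m) (pow w n)))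

pow-* : ∀ w m n → pow w (n * m) ≡ pow (pow w m) n
pow-* w m zero = refl
pow-* w m (suc n) = trans (pow-+ w m (n * m)) (cong (pow w m ++_) (pow-* w m n))

NC-pow : ∀ {S w} → NormalClosure S w → ∀ n → NormalClosure S (pow w n)
NC-pow h zero = nc-one
NC-pow h (suc n) = nc-mul h (NC-pow h n)

NC-pow-multiple : ∀ {S} x {m n} → m ∣ n → NormalClosure S (pow x m) → NormalClosure S (pow x n)
NC-pow-multiple {S} x {m} (divides t refl) h =
  subst (NormalClosure S) (sym (pow-* x m t)) (NC-pow h t)

-- One half of Bézout's identity g + t n = s m: from x^m, x^n ∈ N we get
-- x^{t n} x^g = x^{s m} ∈ N and x^{t n} ∈ N, hence x^g ∈ N.
NC-pow-Bézout : ∀ {S} x m n g s t → g + t * n ≡ s * m →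
  NormalClosure S (pow x m) → NormalClosure S (pow x n) → NormalClosure S (pow x g)
NC-pow-Bézout {S} x m n g s t eq hm hn =
  NC-cancelˡ (pow x (t * n)) (pow x g) x^[tn+g] (NC-pow-multiple x (divides t refl) hn)
  where
  x^[tn+g] : NormalClosure S (pow x (t * n) ++ pow x g)
  x^[tn+g] = subst (NormalClosure S)
    (trans (cong (pow x) (trans (sym eq) (+-comm g (t * n)))) (pow-+ x (t * n) g))
    (NC-pow-multiple x (divides s refl) hm)

NC-pow-gcd : ∀ {S} x m n → NormalClosure S (pow x m) → NormalClosure S (pow x n) →
             NormalClosure S (pow x (gcd m n))
NC-pow-gcd x m n hm hn with Bézout.identity (gcd-GCD m n)
... | Bézout.+- s t eq = NC-pow-Bézout x m n (gcd m n) s t eq hm hn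
... | Bézout.-+ s t eq = NC-pow-Bézout x n m (gcd m n) t s eq hn hm

bc∈Hrel : ∀ m → pow (b ++ c) m ∈ Hrel m
bc∈Hrel m = there (there (there (there (there (here refl)))))

bac∈Hrel : ∀ m → pow (b ++ a ++ c) m ∈ Hrel m
bac∈Hrel m = there (there (there (there (there (there (here refl))))))

-- ⟨⟨H_m⟩⟩ ⊆ ⟨⟨H_n⟩⟩ once (bc)^m and (bac)^m lie in ⟨⟨H_n⟩⟩, since the
-- remaining five relators are shared.
Hrel-⊆ : ∀ m n →
  NormalClosure (Hrel n) (pow (b ++ c) m) → NormalClosure (Hrel n) (pow (b ++ a ++ c) m) →
  ∀ {w} → NormalClosure (Hrel m) w → NormalClosure (Hrel n) w
Hrel-⊆ m n hbc hbac = NC-⊆ relator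
  where
  relator : ∀ {r} → r ∈ Hrel m → NormalClosure (Hrel n) r
  relator (here eq) = NC-relator (here eq)
  relator (there (here eq)) = NC-relator (there (here eq))
  relator (there (there (here eq))) = NC-relator (there (there (here eq)))
  relator (there (there (there (here eq)))) = NC-relator (there (there (there (here eq))))
  relator (there (there (there (there (here eq))))) = NC-relator (there (there (there (there (here eq)))))
  relator (there (there (there (there (there (here refl)))))) = hbc
  relator (there (there (there (there (there (there (here refl))))))) = hbac

Hrel-divides : ∀ m n → m ∣ n → ∀ {w} → NormalClosure (Hrel n) w → NormalClosure (Hrel m) w
Hrel-divides m n m∣n =
  Hrel-⊆ n m (NC-pow-multiple (b ++ c) m∣n (NC-relator (bc∈Hrel m)))
             (NC-pow-multiple (b ++ a ++ c) m∣n (NC-relator (bac∈Hrel m)))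

Hrel-divide-out : ∀ q z p → Coprime z p →
  SamePresentation (Hrel (q * z * p)) (Hrel (q * z)) →
  SamePresentation (Hrel (q * p)) (Hrel q)
Hrel-divide-out q z p z⊥p (_ , qz⊆qzp) =
  (λ _ → Hrel-divides q (q * p) (m∣m*n p)) ,
  (λ _ → Hrel-⊆ q (q * p) (power-q (b ++ c) bc∈Hrel) (power-q (b ++ a ++ c) bac∈Hrel))
  where
  gcd[qz,qp]≡q : gcd (q * z) (q * p) ≡ q
  gcd[qz,qp]≡q = begin
    gcd (q * z) (q * p)  ≡⟨ sym (c*gcd[m,n]≡gcd[cm,cn] q z p) ⟩
    q * gcd z p          ≡⟨ cong (q *_) (coprime⇒gcd≡1 z⊥p) ⟩
    q * 1                ≡⟨ *-identityʳ q ⟩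
    q                    ∎
  -- x^{qz} ∈ ⟨⟨H_{qz}⟩⟩ = ⟨⟨H_{qzp}⟩⟩ ⊆ ⟨⟨H_{qp}⟩⟩ and x^{qp} ∈ ⟨⟨H_{qp}⟩⟩.
  power-q : ∀ x → (∀ m → pow x m ∈ Hrel m) → NormalClosure (Hrel (q * p)) (pow x q)
  power-q x x∈ =
    subst (λ e → NormalClosure (Hrel (q * p)) (pow x e)) gcd[qz,qp]≡q
      (NC-pow-gcd x (q * z) (q * p)
        (Hrel-divides (q * p) (q * z * p) (*-monoˡ-∣ p (m∣m*n {q} z)) (qz⊆qzp _ (NC-relator (x∈ (q * z)))))
        (NC-relator (x∈ (q * p))))

prime∤⇒coprime : ∀ {p z} → Prime p → ¬ (p ∣ z) → Coprime z p
prime∤⇒coprime pp p∤z (d∣z , d∣p) with prime⇒irreducible pp d∣p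
... | inj₁ d≡1 = d≡1
... | inj₂ refl = ⊥-elim (p∤z d∣z)

qzp/z≡qp : ∀ q z p .{{_ : NonZero z}} → (q * z * p) / z ≡ q * p
qzp/z≡qp q z p = begin
  q * z * p / z    ≡⟨ cong (_/ z) (*-assoc q z p) ⟩
  q * (z * p) / z  ≡⟨ cong (λ t → q * t / z) (*-comm z p) ⟩
  q * (p * z) / z  ≡⟨ cong (_/ z) (sym (*-assoc q p z)) ⟩
  q * p * z / z    ≡⟨ m*n/n≡m (q * p) z ⟩
  q * p            ∎

lemma6p17 : (k p z : ℕ) → .{{_ : NonZero k}} → .{{_ : NonZero z}} →
    Prime p → z ∣ k → ¬ (p ∣ z) →
    SamePresentation (Hrel (k * p)) (Hrel k) →
    SamePresentation (Hrel ((k * p) / z)) (Hrel (k / z))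
lemma6p17 .(q * z) p z pp (divides q refl) p∤z same =
  subst₂ (λ s t → SamePresentation (Hrel s) (Hrel t)) (sym (qzp/z≡qp q z p)) (sym (m*n/n≡m q z))
    (Hrel-divide-out q z p (prime∤⇒coprime pp p∤z) same)
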